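{- Let $A$ and $B$ be two asynchronously composable IOTSes such that at least one of the following holds: (a) $A\otimes_{as}B$ satisfies property $\mathcal{P}$; (b) $A\otimes_{as}B$ is half-duplex; (c) for each $(s_A,s_B)\in\mathit{reach}(A\otimes B)$ and all transitions $s_A\xrightarrow{a}_A s_A'$, $s_B\xrightarrow{b}_B s_B'$, either $a\notin\mathit{out}_A\cap\mathit{in}_B$ or $b\notin\mathit{out}_B\cap\mathit{in}_A$. Then: (1) $A$ and $B$ are strongly synchronously compatible if and only if they are strongly asynchronously compatible; (2) $A$ and $B$ are weakly synchronously compatible if and only if they are weakly asynchronously compatible.
   Context: An IOTS $A=(\mathit{states}_A,\mathit{start}_A,\mathit{act}_A,\to_A)$ has states, initial state, actions $\mathit{act}_A=\mathit{in}_A\cup\mathit{out}_A\cup\mathit{int}_A$ (disjoint union of inputs, outputs, internal actions) and transitions $s\xrightarrow{a}_A s'$. $s\ (\xrightarrow{X})^*_A\ s'$ denotes a possibly empty finite sequence of transitions labelled in $X$; $\mathit{reach}(A)$ is the set of states reachable from $\mathit{start}_A$. $A,B$ are composable if $\mathit{act}_A\cap\mathit{act}_B=(\mathit{in}_A\cap\mathit{out}_B)\cup(\mathit{in}_B\cap\mathit{out}_A)=:\mathit{shared}(A,B)$. Synchronous composition $A\otimes B$: states $\mathit{states}_A\times\mathit{states}_B$, initial $(\mathit{start}_A,\mathit{start}_B)$, inputs $(\mathit{in}_A\cup\mathit{in}_B)\setminus\mathit{shared}(A,B)$, outputs $(\mathit{out}_A\cup\mathit{out}_B)\setminus\mathit{shared}(A,B)$,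 internal $\mathit{int}_A\cup\mathit{int}_B\cup\mathit{shared}(A,B)$; a non-shared action of one component moves only that component; a shared action $a$ yields $(s,t)\xrightarrow{a}(s',t')$ when $s\xrightarrow{a}_A s'$ and $t\xrightarrow{a}_B t'$. For a set $M$, $M^\rhd=\{a^\rhd\mid a\in M\}$ are fresh names. $A,B$ are asynchronously composable if composable and $\mathit{shared}(A,B)^\rhd\cap(\mathit{act}_A\cup\mathit{act}_B)=\emptyset$. With $\mathit{out}_{AB}=\mathit{out}_A\cap\mathit{in}_B$, $\Omega(A)$ is the IOTS with states $(s,q)$, $s\in\mathit{states}_A$, $q\in\mathit{out}_{AB}^*$, initial $(\mathit{start}_A,\epsilon)$, inputs $\mathit{in}_A$, outputs $\mathit{out}_A$, internal actions $\mathit{int}_A\cup\mathit{out}_{AB}^\rhd$, transitions $(s,q)\xrightarrow{a}(s',q)$ if $s\xrightarrow{a}_A s'$, $a\notin\mathit{out}_{AB}$; $(s,q)\xrightarrow{a^\rhd}(s',qa)$ if $s\xrightarrow{a}_A s'$, $a\in\mathit{out}_{AB}$; $(s,aq)\xrightarrow{a}(s,q)$ for $a\in\mathit{out}_{AB}$. $\Omega(B)$ analogously with $\mathit{out}_{BA}=\mathit{out}_B\cap\mathit{in}_A$. $A\otimes_{as}B=\Omega(A)\otimes\Omega(B)$, initial state $((\mathit{start}_A,\epsilon),(\mathit{start}_B,\epsilon))$. $A,B$ are strongly synchronously compatible if composable and for all $(s_A,s_B)\in\mathit{reach}(A\otimes B)$ and $a\in\mathit{out}_A\cap\mathit{in}_B$: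 if $s_A\xrightarrow{a}_A s_A'$ for some $s_A'$ then $s_B\xrightarrow{a}_B s_B'$ for some $s_B'$; and symmetrically for $b\in\mathit{out}_B\cap\mathit{in}_A$. Weakly synchronously compatible: same with conclusion $s_B\ (\xrightarrow{\mathit{int}_B})^*_B\ \bar s_B\xrightarrow{a}_B s_B'$ for some $\bar s_B,s_B'$ (symmetrically with $\mathit{int}_A$). Asynchronously composable $A,B$ are strongly (weakly) asynchronously compatible if $\Omega(A)$ and $\Omega(B)$ are strongly (weakly) synchronously compatible. $A\otimes_{as}B$ is half-duplex if each reachable state $((s_A,q_A),(s_B,q_B))$ of $\Omega(A)\otimes\Omega(B)$ has $q_A=\epsilon$ or $q_B=\epsilon$. Property $\mathcal{P}$: with $F_A=\mathit{act}_A\setminus\mathit{shared}(A,B)$, for $a\in\mathit{out}_A\cap\mathit{in}_B$ write $s\Rightarrow^a_A s'$ if $s\ (\xrightarrow{F_A})^*_A\ \bar s\xrightarrow{a}_A\bar s'\ (\xrightarrow{F_A})^*_A\ s'$ for some $\bar s,\bar s'$; $\Rightarrow^b_B$ analogously with $F_B$. $\mathcal{P}$ holds if every reachable state $((s_A,q_A),(s_B,q_B))$ satisfies one of: (i) $q_A=q_B=\epsilon$ and $(s_A,s_B)\in\mathit{reach}(A\otimes B)$; (ii) $q_A=a_1\ldots a_m\neq\epsilon$, $q_B=\epsilon$, and some $r_A$ has $(r_A,s_B)\in\mathit{reach}(A\otimes B)$ and $r_A\Rightarrow^{a_1}_A\cdots\Rightarrow^{a_m}_A s_A$; (iii) $q_A=\epsilon$,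 $q_B=b_1\ldots b_m\neq\epsilon$, and some $r_B$ has $(s_A,r_B)\in\mathit{reach}(A\otimes B)$ and $r_B\Rightarrow^{b_1}_B\cdots\Rightarrow^{b_m}_B s_B$. -}

module Defs where

open import Data.Product using (Σ; ∃; ∃-syntax; _×_; _,_)
open import Data.Sum using (_⊎_)
open import Data.List using (List; []; _∷_; _++_; [_])
open import Relation.Nullary using (¬_)
open import Relation.Unary using (Pred; _∈_; _∉_; _∩_; _∪_; _⊆_; _≐_)
open import Relation.Binary.PropositionalEquality using (_≡_; _≢_)
open import Function.Definitions using (Injective)
open import Level using (0ℓ)

record IOTS (Act : Set) : Set₁ where
  field
    states : Set
    start  : states
    inp    : Pred Act 0ℓ
    out    : Pred Act 0ℓ
    int    : Pred Act 0ℓ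
    _-[_]→_ : states → Act → states → Set

  act : Pred Act 0ℓ
  act = inp ∪ out ∪ int

open IOTS public

Trans : ∀ {Act} (A : IOTS Act) → states A → Act → states A → Set
Trans A = IOTS._-[_]→_ A

record WellFormed {Act : Set} (A : IOTS Act) : Set where
  field
    in-out  : ∀ a → a ∈ inp A → a ∉ out A
    in-int  : ∀ a → a ∈ inp A → a ∉ int A
    out-int : ∀ a → a ∈ out A → a ∉ int A
    labels  : ∀ {s a s'} → Trans A s a s' → a ∈ act A


module _ {Act : Set} where

  shared : IOTS Act → IOTS Act → Pred Act 0ℓ
  shared A B = (inp A ∩ out B) ∪ (inp B ∩ out A)

  Composable : IOTS Act → IOTS Act → Set
  Composable A B = (act A ∩ act B) ≐ shared A B

  data Step⊗ (A B : IOTS Act) : states A × states B → Act → states A × states B → Set where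
    left  : ∀ {s s' t a} → a ∈ act A → a ∉ shared A B → Trans A s a s' →
            Step⊗ A B (s , t) a (s' , t)
    right : ∀ {s t t' a} → a ∈ act B → a ∉ shared A B → Trans B t a t' →
            Step⊗ A B (s , t) a (s , t')
    sync  : ∀ {s s' t t' a} → a ∈ shared A B → Trans A s a s' → Trans B t a t' →
            Step⊗ A B (s , t) a (s' , t')

  data Reach (A B : IOTS Act) : states A × states B → Set where
    init : Reach A B (start A , start B)
    step : ∀ {p a p'} → Reach A B p → Step⊗ A B p a p' → Reach A B p'

  data Path (A : IOTS Act) (X : Pred Act 0ℓ) : states A → states A → Set where
    done : ∀ {s} → Path A X s s
    more : ∀ {s a s' s''} → a ∈ X → Trans A s a s' → Path A X s' s'' → Path A X s s''

  StronglySyncCompatible : IOTS Act → IOTS Act → Set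
  StronglySyncCompatible A B =
    Composable A B ×
    (∀ sA sB → Reach A B (sA , sB) →
       (∀ a → a ∈ out A → a ∈ inp B → ∀ sA' → Trans A sA a sA' →
          ∃[ sB' ] Trans B sB a sB') ×
       (∀ b → b ∈ out B → b ∈ inp A → ∀ sB' → Trans B sB b sB' →
          ∃[ sA' ] Trans A sA b sA'))

  WeaklySyncCompatible : IOTS Act → IOTS Act → Set
  WeaklySyncCompatible A B =
    Composable A B ×
    (∀ sA sB → Reach A B (sA , sB) →
       (∀ a → a ∈ out A → a ∈ inp B → ∀ sA' → Trans A sA a sA' →
          ∃[ s̄B ] ∃[ sB' ] (Path B (int B) sB s̄B × Trans B s̄B a sB')) ×
       (∀ b → b ∈ out B → b ∈ inp A → ∀ sB' → Trans B sB b sB' →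
          ∃[ s̄A ] ∃[ sA' ] (Path A (int A) sA s̄A × Trans A s̄A b sA')))

  -- Asynchronous composition.  ▷ : Act → Act  gives the fresh names a^▷.

  AsyncComposable : (Act → Act) → IOTS Act → IOTS Act → Set
  AsyncComposable ▷ A B =
    Composable A B × (∀ a → a ∈ shared A B → ▷ a ∉ act A × ▷ a ∉ act B)

  outTo : IOTS Act → IOTS Act → Pred Act 0ℓ
  outTo A B = out A ∩ inp B

  data ΩTrans (▷ : Act → Act) (A B : IOTS Act) :
       states A × List Act → Act → states A × List Act → Set where
    plain : ∀ {s s' q a} → Trans A s a s' → a ∉ outTo A B →
            ΩTrans ▷ A B (s , q) a (s' , q)
    push  : ∀ {s s' q a} → Trans A s a s' → a ∈ outTo A B →
            ΩTrans ▷ A B (s , q) (▷ a) (s' , q ++ [ a ])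
    pop   : ∀ {s q a} → a ∈ outTo A B →
            ΩTrans ▷ A B (s , a ∷ q) a (s , q)

  Ω : (Act → Act) → IOTS Act → IOTS Act → IOTS Act
  Ω ▷ A B = record
    { states = states A × List Act
    ; start  = (start A , [])
    ; inp    = inp A
    ; out    = out A
    ; int    = int A ∪ (λ x → ∃[ a ] (a ∈ outTo A B × x ≡ ▷ a))
    ; _-[_]→_ = ΩTrans ▷ A B
    }

  StronglyAsyncCompatible : (Act → Act) → IOTS Act → IOTS Act → Set
  StronglyAsyncCompatible ▷ A B =
    AsyncComposable ▷ A B × StronglySyncCompatible (Ω ▷ A B) (Ω ▷ B A)

  WeaklyAsyncCompatible : (Act → Act) → IOTS Act → IOTS Act → Set
  WeaklyAsyncCompatible ▷ A B =
    AsyncComposable ▷ A B × WeaklySyncCompatible (Ω ▷ A B) (Ω ▷ B A)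

  -- reachable states of A ⊗_as B = Ω(A) ⊗ Ω(B)
  ReachAs : (Act → Act) → (A B : IOTS Act) →
            states A → List Act → states B → List Act → Set
  ReachAs ▷ A B sA qA sB qB = Reach (Ω ▷ A B) (Ω ▷ B A) ((sA , qA) , (sB , qB))

  HalfDuplex : (Act → Act) → IOTS Act → IOTS Act → Set
  HalfDuplex ▷ A B = ∀ sA qA sB qB → ReachAs ▷ A B sA qA sB qB → qA ≡ [] ⊎ qB ≡ []

  F : IOTS Act → IOTS Act → Pred Act 0ℓ
  F A B = λ a → a ∈ act A × a ∉ shared A B

  WeakStep : (A B : IOTS Act) → states A → Act → states A → Set
  WeakStep A B s a s' =
    ∃[ s̄ ] ∃[ s̄' ] (Path A (F A B) s s̄ × Trans A s̄ a s̄' × Path A (F A B) s̄' s')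

  data WeakSteps (A B : IOTS Act) : List Act → states A → states A → Set where
    []  : ∀ {s} → WeakSteps A B [] s s
    _∷_ : ∀ {s a t as u} → WeakStep A B s a t → WeakSteps A B as t u →
          WeakSteps A B (a ∷ as) s u

  PropertyP : (Act → Act) → IOTS Act → IOTS Act → Set
  PropertyP ▷ A B = ∀ sA qA sB qB → ReachAs ▷ A B sA qA sB qB →
      (qA ≡ [] × qB ≡ [] × Reach A B (sA , sB))
    ⊎ (qA ≢ [] × qB ≡ [] × ∃[ rA ] (Reach A B (rA , sB) × WeakSteps A B qA rA sA))
    ⊎ (qA ≡ [] × qB ≢ [] × ∃[ rB ] (Reach A B (sA , rB) × WeakSteps B A qB rB sB))

  NoMixedSends : IOTS Act → IOTS Act → Set
  NoMixedSends A B = ∀ sA sB → Reach A B (sA , sB) →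
    ∀ a sA' b sB' → Trans A sA a sA' → Trans B sB b sB' →
    a ∉ outTo A B ⊎ b ∉ outTo B A

module Submission where

-- Under any of (a)–(c), every reachable configuration of Ω(A) ⊗ Ω(B) is explained by A ⊗ B: at most
-- one queue is nonempty, and it holds what its owner sent since a synchronously reachable state. This
-- is property P; (b) and (c) imply it because they forbid the receiver from sending while messages are
-- in transit. So a message popped by Ω(A) was offered by A at a synchronously reachable state, where
-- synchronous compatibility lets B accept it. Conversely a synchronous send of A is simulated by
-- pushing it and popping it at once, and Ω(B) with empty queue can only accept it by a step of B; in the
-- weak case Ω(B) cannot push on its internal path since both queues would then be nonempty.

open import Defs
open import Data.Product using (_×_; _,_; proj₁; proj₂; ∃-syntax; swap)
open import Data.Sum using (_⊎_; inj₁; inj₂)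
import Data.Sum as Sum
open import Data.List using (List; []; _∷_; _++_; [_])
open import Data.List.Relation.Unary.All using (All; []; _∷_; tail)
open import Data.List.Relation.Unary.All.Properties using (++⁺)
open import Data.Empty using (⊥; ⊥-elim)
open import Relation.Unary using (_∈_; _∉_)
open import Function.Bundles using (_⇔_; mk⇔)
open import Function.Definitions using (Injective)
open import Relation.Binary.PropositionalEquality using (_≡_; refl)

module _ {Act : Set} where

  shared-swap : ∀ {X Y : IOTS Act} {a} → a ∈ shared X Y → a ∈ shared Y X
  shared-swap (inj₁ p) = inj₂ p
  shared-swap (inj₂ p) = inj₁ p

  ∉shared-swap : ∀ {X Y : IOTS Act} {a} → a ∉ shared X Y → a ∉ shared Y X
  ∉shared-swap {X} {Y} n s = n (shared-swap {Y} {X} s)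

  step-swap : ∀ {X Y : IOTS Act} {p a p'} → Step⊗ X Y p a p' → Step⊗ Y X (swap p) a (swap p')
  step-swap {X} {Y} (left x n t)  = right x (∉shared-swap {X} {Y} n) t
  step-swap {X} {Y} (right x n t) = left x (∉shared-swap {X} {Y} n) t
  step-swap {X} {Y} (sync s t u)  = sync (shared-swap {X} {Y} s) u t

  reach-swap : ∀ {X Y : IOTS Act} {p} → Reach X Y p → Reach Y X (swap p)
  reach-swap init       = init
  reach-swap (step r s) = step (reach-swap r) (step-swap s)

  path-snoc : ∀ {X : IOTS Act} {P s s' a s''} → Path X P s s' → a ∈ P → Trans X s' a s'' → Path X P s s''
  path-snoc done         p t = more p t done
  path-snoc (more p t r) q u = more p t (path-snoc r q u)

  reach-localˡ : ∀ {X Y : IOTS Act} {r r' t} → Reach X Y (r , t) → Path X (F X Y) r r' → Reach X Y (r' , t)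
  reach-localˡ re done                = re
  reach-localˡ re (more (x , n) tr p) = reach-localˡ (step re (left x n tr)) p

  reach-syncWeakStep : ∀ {X Y : IOTS Act} {r t a r' t'} → Reach X Y (r , t) → WeakStep X Y r a r' →
                       a ∈ shared X Y → Trans Y t a t' → Reach X Y (r' , t')
  reach-syncWeakStep re (_ , _ , p , tr , p') sh u = reach-localˡ (step (reach-localˡ re p) (sync sh tr u)) p'

  weakSteps-extend : ∀ {X Y : IOTS Act} {a q r s x s'} → WeakSteps X Y (a ∷ q) r s →
                     x ∈ F X Y → Trans X s x s' → WeakSteps X Y (a ∷ q) r s'
  weakSteps-extend ((s̄ , s̄' , p , t , p') ∷ []) f u = (s̄ , s̄' , p , t , path-snoc p' f u) ∷ []
  weakSteps-extend (w ∷ ws@(_ ∷ _))           f u = w ∷ weakSteps-extend ws f u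

  weakSteps-snoc : ∀ {X Y : IOTS Act} {q r s a s'} → WeakSteps X Y q r s → WeakStep X Y s a s' →
                   WeakSteps X Y (q ++ [ a ]) r s'
  weakSteps-snoc []       w = w ∷ []
  weakSteps-snoc (w' ∷ ws) w = w' ∷ weakSteps-snoc ws w

  ΩTrans-queue : ∀ {▷ : Act → Act} {X Y : IOTS Act} {s q x s' q'} → All (outTo X Y) q →
                 ΩTrans ▷ X Y (s , q) x (s' , q') → All (outTo X Y) q'
  ΩTrans-queue al (plain _ _) = al
  ΩTrans-queue al (push _ o)  = ++⁺ al (o ∷ [])
  ΩTrans-queue al (pop _)     = tail al

  queue-outTo : ∀ {▷ : Act → Act} {X Y : IOTS Act} {sX qX ρY} → Reach (Ω ▷ X Y) (Ω ▷ Y X) ((sX , qX) , ρY) →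
                All (outTo X Y) qX
  queue-outTo init                   = []
  queue-outTo (step r (left _ _ t))  = ΩTrans-queue (queue-outTo r) t
  queue-outTo (step r (right _ _ _)) = queue-outTo r
  queue-outTo (step r (sync _ t _))  = ΩTrans-queue (queue-outTo r) t

  Fresh : (Act → Act) → IOTS Act → IOTS Act → Set
  Fresh ▷ A B = ∀ a → a ∈ shared A B → ▷ a ∉ act A × ▷ a ∉ act B

  fresh-swap : ∀ {▷ : Act → Act} {A B : IOTS Act} → Fresh ▷ A B → Fresh ▷ B A
  fresh-swap {A = A} {B} fresh a s = swap (fresh a (shared-swap {B} {A} s))

  StrongAccept : (X Y : IOTS Act) → states X → states Y → Set
  StrongAccept X Y sX sY = ∀ a → a ∈ out X → a ∈ inp Y → ∀ sX' → Trans X sX a sX' → ∃[ sY' ] Trans Y sY a sY'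

  WeakAccept : (X Y : IOTS Act) → states X → states Y → Set
  WeakAccept X Y sX sY = ∀ a → a ∈ out X → a ∈ inp Y → ∀ sX' → Trans X sX a sX' →
    ∃[ s̄Y ] ∃[ sY' ] (Path Y (int Y) sY s̄Y × Trans Y s̄Y a sY')

  Config : IOTS Act → IOTS Act → Set
  Config A B = (states A × List Act) × (states B × List Act)

  data Explained (A B : IOTS Act) : Config A B → Set where
    inSync     : ∀ {sA sB} → Reach A B (sA , sB) → Explained A B ((sA , []) , (sB , []))
    leftAhead  : ∀ {sA sB rA a q} → Reach A B (rA , sB) → WeakSteps A B (a ∷ q) rA sA →
                 Explained A B ((sA , a ∷ q) , (sB , []))
    rightAhead : ∀ {sA sB rB b q} → Reach A B (sA , rB) → WeakSteps B A (b ∷ q) rB sB →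
                 Explained A B ((sA , []) , (sB , b ∷ q))

  explained-swap : ∀ {A B : IOTS Act} {p} → Explained A B p → Explained B A (swap p)
  explained-swap (inSync re)        = inSync (reach-swap re)
  explained-swap (leftAhead re ws)  = rightAhead (reach-swap re) ws
  explained-swap (rightAhead re ws) = leftAhead (reach-swap re) ws

  ¬both-queued : ∀ {A B : IOTS Act} {sA a qA sB b qB} → Explained A B ((sA , a ∷ qA) , (sB , b ∷ qB)) → ⊥
  ¬both-queued ()

  explained-fromP : ∀ {▷ : Act → Act} {A B : IOTS Act} → PropertyP ▷ A B →
                    ∀ {p} → Reach (Ω ▷ A B) (Ω ▷ B A) p → Explained A B p
  explained-fromP pp r with pp _ _ _ _ r
  ... | inj₁ (refl , refl , re)                         = inSync re
  ... | inj₂ (inj₁ (ne , refl , _ , _ , []))            = ⊥-elim (ne refl)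
  ... | inj₂ (inj₁ (_ , refl , _ , re , ws@(_ ∷ _)))    = leftAhead re ws
  ... | inj₂ (inj₂ (refl , ne , _ , _ , []))            = ⊥-elim (ne refl)
  ... | inj₂ (inj₂ (refl , _ , _ , re , ws@(_ ∷ _)))    = rightAhead re ws

  data Move (A B : IOTS Act) : Config A B → Config A B → Set where
    localˡ : ∀ {sA sA' qA ρB x} → x ∈ F A B → Trans A sA x sA' → Move A B ((sA , qA) , ρB) ((sA' , qA) , ρB)
    localʳ : ∀ {ρA sB sB' qB x} → x ∈ F B A → Trans B sB x sB' → Move A B (ρA , (sB , qB)) (ρA , (sB' , qB))
    sendˡ  : ∀ {sA sA' qA ρB a} → a ∈ outTo A B → Trans A sA a sA' →
             Move A B ((sA , qA) , ρB) ((sA' , qA ++ [ a ]) , ρB)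
    sendʳ  : ∀ {ρA sB sB' qB b} → b ∈ outTo B A → Trans B sB b sB' →
             Move A B (ρA , (sB , qB)) (ρA , (sB' , qB ++ [ b ]))
    recvˡ  : ∀ {sA sA' qA sB qB b} → b ∈ outTo B A → Trans A sA b sA' →
             Move A B ((sA , qA) , (sB , b ∷ qB)) ((sA' , qA) , (sB , qB))
    recvʳ  : ∀ {sA qA sB sB' qB a} → a ∈ outTo A B → Trans B sB a sB' →
             Move A B ((sA , a ∷ qA) , (sB , qB)) ((sA , qA) , (sB' , qB))

  move-swap : ∀ {A B : IOTS Act} {p p'} → Move A B p p' → Move B A (swap p) (swap p')
  move-swap (localˡ f t) = localʳ f t
  move-swap (localʳ f t) = localˡ f t
  move-swap (sendˡ o t)  = sendʳ o t
  move-swap (sendʳ o t)  = sendˡ o t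
  move-swap (recvˡ o t)  = recvʳ o t
  move-swap (recvʳ o t)  = recvˡ o t

module OneSided {Act : Set} (▷ : Act → Act) (A B : IOTS Act)
                (wfA : WellFormed A) (wfB : WellFormed B) (fresh : Fresh ▷ A B) where

  private
    ΩA = Ω ▷ A B
    ΩB = Ω ▷ B A
    module WA = WellFormed wfA
    module WB = WellFormed wfB

  outTo⊆shared : ∀ {a} → a ∈ outTo A B → a ∈ shared A B
  outTo⊆shared (o , i) = inj₂ (i , o)

  outToʳ⊆shared : ∀ {b} → b ∈ outTo B A → b ∈ shared A B
  outToʳ⊆shared (o , i) = inj₁ (i , o)

  shared⊆actˡ : ∀ {a} → a ∈ shared A B → a ∈ act A
  shared⊆actˡ (inj₁ (i , _)) = inj₁ i
  shared⊆actˡ (inj₂ (_ , o)) = inj₂ (inj₁ o)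

  shared⊆actʳ : ∀ {a} → a ∈ shared A B → a ∈ act B
  shared⊆actʳ (inj₁ (_ , o)) = inj₂ (inj₁ o)
  shared⊆actʳ (inj₂ (i , _)) = inj₁ i

  ▷-freshˡ : ∀ {a} → a ∈ outTo A B → ▷ a ∉ act A × ▷ a ∉ act B
  ▷-freshˡ o = fresh _ (outTo⊆shared o)

  ▷-freshʳ : ∀ {b} → b ∈ outTo B A → ▷ b ∉ act A × ▷ b ∉ act B
  ▷-freshʳ o = fresh _ (outToʳ⊆shared o)

  ▷∉sharedˡ : ∀ {a} → a ∈ outTo A B → ▷ a ∉ shared A B
  ▷∉sharedˡ o s = proj₁ (▷-freshˡ o) (shared⊆actˡ s)

  ▷∉sharedʳ : ∀ {b} → b ∈ outTo B A → ▷ b ∉ shared A B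
  ▷∉sharedʳ o s = proj₂ (▷-freshʳ o) (shared⊆actʳ s)

  ▷∈actΩˡ : ∀ {a} → a ∈ outTo A B → ▷ a ∈ act ΩA
  ▷∈actΩˡ o = inj₂ (inj₂ (inj₂ (_ , o , refl)))

  ▷∈actΩʳ : ∀ {b} → b ∈ outTo B A → ▷ b ∈ act ΩB
  ▷∈actΩʳ o = inj₂ (inj₂ (inj₂ (_ , o , refl)))

  classify : ∀ {p x p'} → Step⊗ ΩA ΩB p x p' → Move A B p p'
  classify (left _ n (plain t _))  = localˡ (WA.labels t , n) t
  classify (left _ _ (push t o))   = sendˡ o t
  classify (left _ n (pop o))      = ⊥-elim (n (outTo⊆shared o))
  classify (right _ n (plain u _)) = localʳ (WB.labels u , ∉shared-swap {X = A} {Y = B} n) u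
  classify (right _ _ (push u o))  = sendʳ o u
  classify (right _ n (pop o))     = ⊥-elim (n (outToʳ⊆shared o))
  classify (sync _ (pop o) (plain u _))             = recvʳ o u
  classify (sync _ (plain t _) (pop o))             = recvˡ o t
  classify (sync (inj₁ (i , o)) (plain _ _) (plain _ n)) = ⊥-elim (n (o , i))
  classify (sync (inj₂ (i , o)) (plain _ n) (plain _ _)) = ⊥-elim (n (o , i))
  classify (sync sh (push _ o) _)                   = ⊥-elim (▷∉sharedˡ o sh)
  classify (sync sh (plain _ _) (push _ o))         = ⊥-elim (▷∉sharedʳ o sh)
  classify (sync sh (pop _) (push _ o))             = ⊥-elim (▷∉sharedʳ o sh)
  classify (sync _ (pop o) (pop o'))                = ⊥-elim (WA.in-out _ (proj₂ o') (proj₁ o))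

  actΩA : ∀ {a} → a ∈ act A → a ∈ act ΩA
  actΩA (inj₁ i)        = inj₁ i
  actΩA (inj₂ (inj₁ o)) = inj₂ (inj₁ o)
  actΩA (inj₂ (inj₂ n)) = inj₂ (inj₂ (inj₁ n))

  actΩB : ∀ {b} → b ∈ act B → b ∈ act ΩB
  actΩB (inj₁ i)        = inj₁ i
  actΩB (inj₂ (inj₁ o)) = inj₂ (inj₁ o)
  actΩB (inj₂ (inj₂ n)) = inj₂ (inj₂ (inj₁ n))

  Ω-composable : Injective _≡_ _≡_ ▷ → Composable A B → Composable ΩA ΩB
  Ω-composable inj (act∩⊆shared , _) =
    (λ (x , y) → common (split-actΩA x) (split-actΩB y)) ,
    (λ s → actΩA (shared⊆actˡ s) , actΩB (shared⊆actʳ s))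
    where
    split-actΩA : ∀ {x} → x ∈ act ΩA → x ∈ act A ⊎ ∃[ a ] (a ∈ outTo A B × x ≡ ▷ a)
    split-actΩA (inj₁ i)               = inj₁ (inj₁ i)
    split-actΩA (inj₂ (inj₁ o))        = inj₁ (inj₂ (inj₁ o))
    split-actΩA (inj₂ (inj₂ (inj₁ n))) = inj₁ (inj₂ (inj₂ n))
    split-actΩA (inj₂ (inj₂ (inj₂ e))) = inj₂ e

    split-actΩB : ∀ {x} → x ∈ act ΩB → x ∈ act B ⊎ ∃[ b ] (b ∈ outTo B A × x ≡ ▷ b)
    split-actΩB (inj₁ i)               = inj₁ (inj₁ i)
    split-actΩB (inj₂ (inj₁ o))        = inj₁ (inj₂ (inj₁ o))
    split-actΩB (inj₂ (inj₂ (inj₁ n))) = inj₁ (inj₂ (inj₂ n))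
    split-actΩB (inj₂ (inj₂ (inj₂ e))) = inj₂ e

    common : ∀ {x} → x ∈ act A ⊎ ∃[ a ] (a ∈ outTo A B × x ≡ ▷ a) →
             x ∈ act B ⊎ ∃[ b ] (b ∈ outTo B A × x ≡ ▷ b) → x ∈ shared A B
    common (inj₁ x) (inj₁ y)              = act∩⊆shared (x , y)
    common (inj₁ x) (inj₂ (_ , o , refl)) = ⊥-elim (proj₁ (▷-freshʳ o) x)
    common (inj₂ (_ , o , refl)) (inj₁ y) = ⊥-elim (proj₂ (▷-freshˡ o) y)
    common (inj₂ (a , o , refl)) (inj₂ (_ , o' , e)) with inj e
    ... | refl = ⊥-elim (WA.in-out a (proj₂ o') (proj₁ o))

  -- A synchronous hand-over is simulated by a send immediately followed by its receipt.
  lift-reach : ∀ {sA sB} → Reach A B (sA , sB) → Reach ΩA ΩB ((sA , []) , (sB , []))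
  lift-reach init = init
  lift-reach (step r (left x n t))  = step (lift-reach r) (left (actΩA x) n (plain t (λ o → n (outTo⊆shared o))))
  lift-reach (step r (right x n u)) = step (lift-reach r) (right (actΩB x) n (plain u (λ o → n (outToʳ⊆shared o))))
  lift-reach (step r (sync sh@(inj₁ (i , o)) t u)) =
    step (step (lift-reach r) (right (▷∈actΩʳ (o , i)) (▷∉sharedʳ (o , i)) (push u (o , i))))
         (sync sh (plain t (λ o' → WA.in-out _ i (proj₁ o'))) (pop (o , i)))
  lift-reach (step r (sync sh@(inj₂ (i , o)) t u)) =
    step (step (lift-reach r) (left (▷∈actΩˡ (o , i)) (▷∉sharedˡ (o , i)) (push t (o , i))))
         (sync sh (pop (o , i)) (plain u (λ o' → WB.in-out _ i (proj₁ o'))))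

  send-reachable : ∀ {sA sB a sA'} → Reach A B (sA , sB) → Trans A sA a sA' → a ∈ outTo A B →
                   Reach ΩA ΩB ((sA' , [ a ]) , (sB , []))
  send-reachable r t o = step (lift-reach r) (left (▷∈actΩˡ o) (▷∉sharedˡ o) (push t o))

  SendBlocked : Set
  SendBlocked = ∀ {sA a q sB rA b sB'} → Reach ΩA ΩB ((sA , a ∷ q) , (sB , [])) →
                Reach A B (rA , sB) → WeakSteps A B (a ∷ q) rA sA → Trans B sB b sB' → b ∈ outTo B A → ⊥

  halfDuplex⇒sendBlocked : HalfDuplex ▷ A B → SendBlocked
  halfDuplex⇒sendBlocked hd r _ _ u o with hd _ _ _ _ (step r (right (▷∈actΩʳ o) (▷∉sharedʳ o) (push u o)))
  ... | inj₁ ()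
  ... | inj₂ ()

  -- The first pending message of A was sent from a synchronously reachable state at which B can send.
  noMixedSends⇒sendBlocked : NoMixedSends A B → SendBlocked
  noMixedSends⇒sendBlocked nms r re ((_ , _ , p , t , _) ∷ _) u o
    with queue-outTo r | nms _ _ (reach-localˡ re p) _ _ _ _ t u
  ... | oa ∷ _ | inj₁ a∉ = a∉ oa
  ... | _      | inj₂ b∉ = b∉ o

  explained-move-inSync : ∀ {sA sB p'} → Reach A B (sA , sB) → Move A B ((sA , []) , (sB , [])) p' → Explained A B p'
  explained-move-inSync re (localˡ (x , n) t) = inSync (step re (left x n t))
  explained-move-inSync re (localʳ (x , n) u) = inSync (step re (right x (∉shared-swap {X = B} {Y = A} n) u))
  explained-move-inSync re (sendˡ _ t)        = leftAhead re ((_ , _ , done , t , done) ∷ [])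
  explained-move-inSync re (sendʳ _ u)        = rightAhead re ((_ , _ , done , u , done) ∷ [])

  explained-move-leftAhead : SendBlocked → ∀ {sA a q sB rA p'} → Reach ΩA ΩB ((sA , a ∷ q) , (sB , [])) →
                      Reach A B (rA , sB) → WeakSteps A B (a ∷ q) rA sA →
                      Move A B ((sA , a ∷ q) , (sB , [])) p' → Explained A B p'
  explained-move-leftAhead _ _ re ws (localˡ f t)       = leftAhead re (weakSteps-extend ws f t)
  explained-move-leftAhead _ _ re ws (localʳ (x , n) u) = leftAhead (step re (right x (∉shared-swap {X = B} {Y = A} n) u)) ws
  explained-move-leftAhead _ _ re ws (sendˡ _ t)        = leftAhead re (weakSteps-snoc ws (_ , _ , done , t , done))
  explained-move-leftAhead blocked r re ws (sendʳ o u)  = ⊥-elim (blocked r re ws u o)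
  explained-move-leftAhead _ _ re (w ∷ []) (recvʳ o u)  = inSync (reach-syncWeakStep re w (outTo⊆shared o) u)
  explained-move-leftAhead _ _ re (w ∷ ws@(_ ∷ _)) (recvʳ o u) =
    leftAhead (reach-syncWeakStep re w (outTo⊆shared o) u) ws

  int∉shared : ∀ {x} → x ∈ int B → x ∉ shared A B
  int∉shared n (inj₁ (_ , o)) = WB.out-int _ o n
  int∉shared n (inj₂ (i , _)) = WB.in-int _ i n

  receive : ∀ {sB q a sB'} → a ∈ inp B → Trans B sB a sB' → ΩTrans ▷ B A (sB , q) a (sB' , q)
  receive i u = plain u (λ o → WB.in-out _ i (proj₁ o))

  received : ∀ {sB q a sB' q'} → a ∈ inp B → ΩTrans ▷ B A (sB , q) a (sB' , q') → Trans B sB a sB'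
  received _ (plain u _) = u
  received i (push _ o)  = ⊥-elim (proj₂ (▷-freshʳ o) (inj₁ i))
  received i (pop o)     = ⊥-elim (WB.in-out _ i (proj₁ o))

  lift-int : ∀ {s s' q} → Path B (int B) s s' → Path ΩB (int ΩB) (s , q) (s' , q)
  lift-int done         = done
  lift-int (more n u p) = more (inj₁ n) (plain u (λ o → WB.out-int _ (proj₁ o) n)) (lift-int p)

  strongAccept-sync : (∀ {ρA ρB} → Reach ΩA ΩB (ρA , ρB) → StrongAccept ΩA ΩB ρA ρB) →
                      ∀ {sA sB} → Reach A B (sA , sB) → StrongAccept A B sA sB
  strongAccept-sync acc re a oa ib _ t =
    let (_ , u) = acc (send-reachable re t (oa , ib)) a oa ib _ (pop (oa , ib))
    in _ , received ib u

  module Compatibility (explained : ∀ {p} → Reach ΩA ΩB p → Explained A B p) where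

    sent-from-queue : ∀ {sA qA sB qB a ρ} → a ∈ out A → a ∈ inp B → Reach ΩA ΩB ((sA , qA) , (sB , qB)) →
                      ΩTrans ▷ A B (sA , qA) a ρ → ∃[ r ] ∃[ r' ] (Reach A B (r , sB) × Trans A r a r')
    sent-from-queue oa ib _ (plain _ n) = ⊥-elim (n (oa , ib))
    sent-from-queue oa _  _ (push _ o)  = ⊥-elim (proj₁ (▷-freshˡ o) (inj₂ (inj₁ oa)))
    sent-from-queue _  _  r (pop _)     = head-sent (explained r)
      where
      head-sent : ∀ {sA a q sB qB} → Explained A B ((sA , a ∷ q) , (sB , qB)) →
                  ∃[ r ] ∃[ r' ] (Reach A B (r , sB) × Trans A r a r')
      head-sent (leftAhead re ((r , r' , p , t , _) ∷ _)) = r , r' , reach-localˡ re p , t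

    strongAccept-async : (∀ {sA sB} → Reach A B (sA , sB) → StrongAccept A B sA sB) →
                         ∀ {ρA ρB} → Reach ΩA ΩB (ρA , ρB) → StrongAccept ΩA ΩB ρA ρB
    strongAccept-async acc r a oa ib _ t =
      let (_ , r' , re , t') = sent-from-queue oa ib r t
          (_ , u)           = acc re a oa ib r' t'
      in _ , receive ib u

    weakAccept-async : (∀ {sA sB} → Reach A B (sA , sB) → WeakAccept A B sA sB) →
                       ∀ {ρA ρB} → Reach ΩA ΩB (ρA , ρB) → WeakAccept ΩA ΩB ρA ρB
    weakAccept-async acc r a oa ib _ t =
      let (_ , r' , re , t') = sent-from-queue oa ib r t
          (_ , _ , p , u)    = acc re a oa ib r' t'
      in _ , _ , lift-int p , receive ib u

    -- Ω(B) cannot push while A's queue is nonempty, so its internal path is one of B.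
    int-path-sync : ∀ {sA a q sB s̄ b ρ} → Reach ΩA ΩB ((sA , a ∷ q) , (sB , [])) →
                    Path ΩB (int ΩB) (sB , []) s̄ → b ∈ inp B → ΩTrans ▷ B A s̄ b ρ →
                    ∃[ s̄B ] ∃[ sB' ] (Path B (int B) sB s̄B × Trans B s̄B b sB')
    int-path-sync _ done ib u = _ , _ , done , received ib u
    int-path-sync r (more _ (push u o) _) _ _ =
      ⊥-elim (¬both-queued (explained (step r (right (▷∈actΩʳ o) (▷∉sharedʳ o) (push u o)))))
    int-path-sync r (more (inj₁ n) (plain u m) p) ib u' =
      let (_ , _ , p' , u'') = int-path-sync (step r (right (actΩB (inj₂ (inj₂ n))) (int∉shared n) (plain u m))) p ib u'
      in _ , _ , more n u p' , u''
    int-path-sync _ (more (inj₂ (_ , o , refl)) (plain u _) _) _ _ = ⊥-elim (proj₂ (▷-freshʳ o) (WB.labels u))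

    weakAccept-sync : (∀ {ρA ρB} → Reach ΩA ΩB (ρA , ρB) → WeakAccept ΩA ΩB ρA ρB) →
                      ∀ {sA sB} → Reach A B (sA , sB) → WeakAccept A B sA sB
    weakAccept-sync acc re a oa ib _ t =
      let r               = send-reachable re t (oa , ib)
          (_ , _ , p , u) = acc r a oa ib _ (pop (oa , ib))
      in int-path-sync r p ib u

module TwoSided {Act : Set} (▷ : Act → Act) (A B : IOTS Act)
                (wfA : WellFormed A) (wfB : WellFormed B) (fresh : Fresh ▷ A B) where

  private
    module L = OneSided ▷ A B wfA wfB fresh
    module R = OneSided ▷ B A wfB wfA (fresh-swap {A = A} {B} fresh)
    ΩA = Ω ▷ A B
    ΩB = Ω ▷ B A

  sendBlockedˡ : HalfDuplex ▷ A B ⊎ NoMixedSends A B → L.SendBlocked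
  sendBlockedˡ (inj₁ hd)  = L.halfDuplex⇒sendBlocked hd
  sendBlockedˡ (inj₂ nms) = L.noMixedSends⇒sendBlocked nms

  sendBlockedʳ : HalfDuplex ▷ A B ⊎ NoMixedSends A B → R.SendBlocked
  sendBlockedʳ (inj₁ hd)  = R.halfDuplex⇒sendBlocked λ sB qB sA qA r → Sum.swap (hd sA qA sB qB (reach-swap r))
  sendBlockedʳ (inj₂ nms) = R.noMixedSends⇒sendBlocked λ sB sA r b sB' a sA' u t →
    Sum.swap (nms sA sB (reach-swap r) a sA' b sB' t u)

  explained-move : HalfDuplex ▷ A B ⊎ NoMixedSends A B → ∀ {p p'} → Reach ΩA ΩB p →
            Explained A B p → Move A B p p' → Explained A B p'
  explained-move _ _ (inSync re)        m = L.explained-move-inSync re m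
  explained-move c r (leftAhead re ws)  m = L.explained-move-leftAhead (sendBlockedˡ c) r re ws m
  explained-move c r (rightAhead re ws) m =
    explained-swap (R.explained-move-leftAhead (sendBlockedʳ c) (reach-swap r) (reach-swap re) ws (move-swap m))

  explained-invariant : HalfDuplex ▷ A B ⊎ NoMixedSends A B → ∀ {p} → Reach ΩA ΩB p → Explained A B p
  explained-invariant _ init        = inSync init
  explained-invariant c (step r st) = explained-move c r (explained-invariant c r) (L.classify st)

  explained : PropertyP ▷ A B ⊎ HalfDuplex ▷ A B ⊎ NoMixedSends A B → ∀ {p} → Reach ΩA ΩB p → Explained A B p
  explained (inj₁ pp) = explained-fromP pp
  explained (inj₂ c)  = explained-invariant c

  strongAsync⇒strongSync : StronglyAsyncCompatible ▷ A B → StronglySyncCompatible A B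
  strongAsync⇒strongSync ((comp , _) , _ , acc) = comp , λ _ _ re →
    L.strongAccept-sync (λ r → proj₁ (acc _ _ r)) re ,
    R.strongAccept-sync (λ r → proj₂ (acc _ _ (reach-swap r))) (reach-swap re)

  module _ (hyp : PropertyP ▷ A B ⊎ HalfDuplex ▷ A B ⊎ NoMixedSends A B) where

    private
      module LC = L.Compatibility (explained hyp)
      module RC = R.Compatibility (λ r → explained-swap (explained hyp (reach-swap r)))

    strongSync⇒strongAsync : Injective _≡_ _≡_ ▷ → StronglySyncCompatible A B → StronglyAsyncCompatible ▷ A B
    strongSync⇒strongAsync inj (comp , acc) = (comp , fresh) , L.Ω-composable inj comp , λ _ _ r →
      LC.strongAccept-async (λ re → proj₁ (acc _ _ re)) r ,
      RC.strongAccept-async (λ re → proj₂ (acc _ _ (reach-swap re))) (reach-swap r)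

    weakSync⇒weakAsync : Injective _≡_ _≡_ ▷ → WeaklySyncCompatible A B → WeaklyAsyncCompatible ▷ A B
    weakSync⇒weakAsync inj (comp , acc) = (comp , fresh) , L.Ω-composable inj comp , λ _ _ r →
      LC.weakAccept-async (λ re → proj₁ (acc _ _ re)) r ,
      RC.weakAccept-async (λ re → proj₂ (acc _ _ (reach-swap re))) (reach-swap r)

    weakAsync⇒weakSync : WeaklyAsyncCompatible ▷ A B → WeaklySyncCompatible A B
    weakAsync⇒weakSync ((comp , _) , _ , acc) = comp , λ _ _ re →
      LC.weakAccept-sync (λ r → proj₁ (acc _ _ r)) re ,
      RC.weakAccept-sync (λ r → proj₂ (acc _ _ (reach-swap r))) (reach-swap re)

corollary4p10 : {Act : Set} (▷ : Act → Act) → Injective _≡_ _≡_ ▷ →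
    (A B : IOTS Act) → WellFormed A → WellFormed B →
    AsyncComposable ▷ A B →
    (PropertyP ▷ A B ⊎ HalfDuplex ▷ A B ⊎ NoMixedSends A B) →
    (StronglySyncCompatible A B ⇔ StronglyAsyncCompatible ▷ A B)
    × (WeaklySyncCompatible A B ⇔ WeaklyAsyncCompatible ▷ A B)
corollary4p10 ▷ inj A B wfA wfB (_ , fresh) hyp =
    mk⇔ (strongSync⇒strongAsync hyp inj) strongAsync⇒strongSync
  , mk⇔ (weakSync⇒weakAsync hyp inj) (weakAsync⇒weakSync hyp)
  where open TwoSided ▷ A B wfA wfB fresh
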